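{- Let $V(n)$ denote the number of integers $a$ with $1\le a\le n$ that are regular modulo $n$. Then $\dfrac{V(n+1)}{V(n)}>1$ for infinitely many positive integers $n$, and $\dfrac{V(n+1)}{V(n)}<1$ for infinitely many positive integers $n$.
   Context: For a positive integer $n$, an integer $a$ is called regular modulo $n$ if there exists an integer $x$ such that $a^{2}x\equiv a \pmod n$. $V(n)=\#\{a: 1\le a\le n,\ a \text{ regular modulo } n\}$. -}

module Defs where

open import Data.Nat as ℕ using (ℕ; zero; suc)
open import Data.Integer as ℤ using (ℤ; +_; _*_; _-_; _+_)
open import Data.Integer.Properties as ℤP using ()
open import Data.Integer.DivMod using (_%_; _/_; a≡a%n+[a/n]*n)
open import Data.Integer.Divisibility.Signed using (_∣_; ∣m+n∣n⇒∣m; ∣n⇒∣m*n; ∣m⇒∣m*n; ∣-refl)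
open import Data.Fin as Fin using (Fin; toℕ)
open import Data.Fin.Properties using (any?)
open import Data.Product using (∃; ∃-syntax; _,_)
open import Data.List using (List; length; filter)
open import Data.List.Base using (upTo)
open import Relation.Nullary using (Dec; yes; no; ¬_)
open import Relation.Binary.PropositionalEquality using (_≡_; refl; sym; cong; subst; trans)
open import Data.Integer.Divisibility.Signed using () renaming (_∣?_ to _∣ℤ?_)

Regular : ℕ → ℤ → Set
Regular n a = ∃[ x ] (+ n) ∣ (a * a * x - a)

private
  open import Data.Integer.Base using (NonZero)
  split : ∀ (m : ℕ) (a x : ℤ) .{{_ : ℕ.NonZero m}} →
          a * a * x - a ≡ (a * a * (+ (x % (+ m))) - a) + a * a * ((x / (+ m)) * + m)
  split m a x = trans (cong (λ y → a * a * y - a) (a≡a%n+[a/n]*n x (+ m))) (lemma (a * a) (+ (x % (+ m))) ((x / (+ m)) * + m) a)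
    where
    open import Data.Integer.Tactic.RingSolver
    lemma : ∀ b r q a → b * (r + q) - a ≡ (b * r - a) + b * q
    lemma = solve-∀

Regular? : ∀ n .{{_ : ℕ.NonZero n}} (a : ℤ) → Dec (Regular n a)
Regular? n a with any? (λ (i : Fin n) → (+ n) ∣ℤ? (a * a * (+ toℕ i) - a))
... | yes (i , p) = yes (+ toℕ i , p)
... | no ¬p = no λ { (x , d) → ¬p (Fin.fromℕ< (Data.Integer.DivMod.n%d<d x (+ n)) ,
        subst (λ k → + n ∣ (a * a * (+ k) - a)) (sym (Data.Fin.Properties.toℕ-fromℕ< _))
          (∣m+n∣n⇒∣m (subst (+ n ∣_) (split n a x) d)
                     (∣n⇒∣m*n (a * a) (∣n⇒∣m*n (x / (+ n)) ∣-refl)))) }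
  where import Data.Integer.DivMod; import Data.Fin.Properties

V : ∀ n .{{_ : ℕ.NonZero n}} → ℕ
V n = length (filter (λ a → Regular? n (+ a)) (Data.List.map suc (upTo n)))
  where import Data.List

-- Let p be a prime with p ≡ 3 (mod 4). Every a ∈ [1, p] is regular modulo p (a is invertible
-- or zero), so V(p) = p > p − 1 ≥ V(p − 1). On the other hand 4 ∣ p + 1, and modulo a multiple
-- of 4 no a ≡ 2 (mod 4) is regular, since then a²x − a ≡ 2 (mod 4); so 2 and 6 are missing and
-- V(p + 1) ≤ p − 1 < V(p). Euclid's argument with 4·M! − 1 provides arbitrarily large such p.
module Submission where

open import Defs
open import Data.Nat using (ℕ; suc; _<_; _≤_)
open import Data.Product using (_×_; ∃-syntax)

open import Data.Nat as ℕ using (NonZero; s≤s)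
open import Data.Nat.Primality using (Prime; ¬prime[1]; prime⇒nonZero)
open import Data.Product using (_,_)
open import Data.Sum using (_⊎_; inj₁; inj₂)
open import Data.Empty using (⊥-elim)
open import Relation.Nullary using (¬_; yes; no)
open import Relation.Binary.PropositionalEquality
  using (_≡_; refl; sym; trans; cong; subst; module ≡-Reasoning)

module Regularity where
  open import Data.Nat.Properties using (m≤n⇒m<n∨m≡n)
  open import Data.Nat.Divisibility using (∣⇒≤) renaming (_∣_ to _∣ℕ_)
  open import Data.Nat.Coprimality using (Coprime; prime⇒coprime; coprime-Bézout)
  import Data.Nat.Coprimality as Coprime
  open import Data.Nat.GCD using (module Bézout)
  open import Data.Integer using (ℤ; +_; -_; _+_; _*_; _-_)
  open import Data.Integer.Properties using (pos-*)
  open import Data.Integer.Divisibility.Signed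
    using (_∣_; divides; ∣-refl; ∣-trans; ∣ᵤ⇒∣; ∣⇒∣ᵤ; ∣m⇒∣-m; ∣n⇒∣m*n; ∣m⇒∣m*n; ∣m+n∣m⇒∣n)
  open import Data.Integer.Tactic.RingSolver using (solve-∀; solve)
  open import Data.List using ([]; _∷_)
  open ≡-Reasoning

  divisible⇒regular : ∀ {n a} → + n ∣ a → Regular n a
  divisible⇒regular {a = a} n∣a = + 0 , subst (_ ∣_) (sym (a*a*0-a≡-a a)) (∣m⇒∣-m n∣a)
    where
    a*a*0-a≡-a : ∀ a → a * a * + 0 - a ≡ - a
    a*a*0-a≡-a = solve-∀

  inverse⇒regular : ∀ {n} a x → + n ∣ a * x - + 1 → Regular n a
  inverse⇒regular a x n∣ax-1 = x , subst (_ ∣_) (sym (a*a*x-a≡a*[a*x-1] a x)) (∣n⇒∣m*n a n∣ax-1)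
    where
    a*a*x-a≡a*[a*x-1] : ∀ a x → a * a * x - a ≡ a * (a * x - + 1)
    a*a*x-a≡a*[a*x-1] = solve-∀

  pos-1+m*n≡o*p : ∀ m n o p → 1 ℕ.+ m ℕ.* n ≡ o ℕ.* p → + 1 + + m * + n ≡ + o * + p
  pos-1+m*n≡o*p m n o p eq = begin
    + 1 + + m * + n     ≡⟨ cong (_+_ (+ 1)) (pos-* m n) ⟨
    + (1 ℕ.+ m ℕ.* n)   ≡⟨ cong +_ eq ⟩
    + (o ℕ.* p)         ≡⟨ pos-* o p ⟩
    + o * + p           ∎

  coprime⇒regular : ∀ {a n} → Coprime a n → Regular n (+ a)
  coprime⇒regular {a} {n} a⊥n with coprime-Bézout a⊥n
  ... | Bézout.+- x y eq = inverse⇒regular (+ a) (+ x)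
          (divides (+ y) (+-inverse (+ a) (+ x) (+ y) (+ n) (pos-1+m*n≡o*p y n x a eq)))
    where
    +-inverse : ∀ a x y n → + 1 + y * n ≡ x * a → a * x - + 1 ≡ y * n
    +-inverse a x y n 1+yn≡xa = begin
      a * x - + 1         ≡⟨ solve (a ∷ x ∷ []) ⟩
      x * a - + 1         ≡⟨ cong (_- + 1) 1+yn≡xa ⟨
      + 1 + y * n - + 1   ≡⟨ solve (y ∷ n ∷ []) ⟩
      y * n               ∎
  ... | Bézout.-+ x y eq = inverse⇒regular (+ a) (- + x)
          (divides (- + y) (-+-inverse (+ a) (+ x) (+ y) (+ n) (pos-1+m*n≡o*p x a y n eq)))
    where
    -+-inverse : ∀ a x y n → + 1 + x * a ≡ y * n → a * - x - + 1 ≡ - y * n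
    -+-inverse a x y n 1+xa≡yn = begin
      a * - x - + 1       ≡⟨ solve (a ∷ x ∷ []) ⟩
      - (+ 1 + x * a)     ≡⟨ cong -_ 1+xa≡yn ⟩
      - (y * n)           ≡⟨ solve (y ∷ n ∷ []) ⟩
      - y * n             ∎

  prime⇒regular : ∀ {p a} → Prime p → .{{NonZero a}} → a ℕ.≤ p → Regular p (+ a)
  prime⇒regular p-prime a≤p with m≤n⇒m<n∨m≡n a≤p
  ... | inj₁ a<p  = coprime⇒regular (Coprime.sym (prime⇒coprime p-prime a<p))
  ... | inj₂ refl = divisible⇒regular ∣-refl

  ¬regular-2+4k : ∀ {n} → 4 ∣ℕ n → ∀ k → ¬ Regular n (+ 2 + + 4 * k)
  ¬regular-2+4k 4∣n k (x , n∣a²x-a) = 4∤2 (∣m+n∣m⇒∣n 4∣4q+2 (∣m⇒∣m*n q ∣-refl))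
    where
    q : ℤ
    q = (+ 1 + + 4 * k + + 4 * k * k) * x - k - + 1
    a²x-a≡4q+2 : ∀ k x → (+ 2 + + 4 * k) * (+ 2 + + 4 * k) * x - (+ 2 + + 4 * k)
                       ≡ + 4 * ((+ 1 + + 4 * k + + 4 * k * k) * x - k - + 1) + + 2
    a²x-a≡4q+2 = solve-∀
    4∣4q+2 : + 4 ∣ + 4 * q + + 2
    4∣4q+2 = subst (_ ∣_) (a²x-a≡4q+2 k x) (∣-trans (∣ᵤ⇒∣ 4∣n) n∣a²x-a)
    4∤2 : ¬ (+ 4 ∣ + 2)
    4∤2 4∣2 with ∣⇒≤ (∣⇒∣ᵤ 4∣2)
    ... | s≤s (s≤s ())

open Regularity

open import Data.Nat using (_+_; _*_; _%_; _!; pred; >-nonZero⁻¹)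
open import Data.Nat.Properties
  using (+-comm; _<?_; m≤m+n; ≤-trans; ≤-reflexive; n≤1+n; +-monoʳ-≤; m≤n+m; ≮⇒≥; suc-pred;
         m≤n⇒∃[o]m+o≡n; _!≢0; module ≤-Reasoning)
open import Data.Nat.DivMod using (_/_; m%n<n; %-distribˡ-*; [m+kn]%n≡m%n; m≡m%n+[m/n]*n)
open import Data.Nat.Divisibility
  using (_∣_; divides; ∣-trans; m∣m*n; ∣m⇒∣m*n; m≤n⇒m!∣n!; ∣m+n∣m⇒∣n; ∣1⇒≡1)
open import Data.Nat.Primality.Factorisation using (factorise; PrimeFactorisation)
open import Data.Nat.ListAction using (product)
open import Data.Nat.ListAction.Properties using (∈⇒∣product)
open import Data.List using (List; []; _∷_; _++_; length; filter; map; upTo; applyUpTo)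
open import Data.List.Properties
  using (length-filter; filter-all; filter-reject; length-map; length-upTo; length-applyUpTo)
open import Data.List.Relation.Unary.All as All using (All)
open import Data.List.Relation.Unary.All.Properties using (map⁺; applyUpTo⁺₁)
open import Data.List.Relation.Unary.Any using (Any; here; there)
open import Data.List.Membership.Propositional using (find)
open import Relation.Unary using (Decidable)
import Data.Integer as ℤ

%4≡3-residues : ∀ a b → a < 4 → b < 4 → (a * b) % 4 ≡ 3 → a ≡ 3 ⊎ b ≡ 3
%4≡3-residues 3 b _ _ _ = inj₁ refl
%4≡3-residues a 3 _ _ _ = inj₂ refl
%4≡3-residues 0 0 _ _ ()
%4≡3-residues 0 1 _ _ ()
%4≡3-residues 0 2 _ _ ()
%4≡3-residues 1 0 _ _ ()
%4≡3-residues 1 1 _ _ ()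
%4≡3-residues 1 2 _ _ ()
%4≡3-residues 2 0 _ _ ()
%4≡3-residues 2 1 _ _ ()
%4≡3-residues 2 2 _ _ ()
%4≡3-residues (suc (suc (suc (suc _)))) _ (s≤s (s≤s (s≤s (s≤s ())))) _ _
%4≡3-residues _ (suc (suc (suc (suc _)))) _ (s≤s (s≤s (s≤s (s≤s ())))) _

*-%4≡3⇒ : ∀ a b → (a * b) % 4 ≡ 3 → a % 4 ≡ 3 ⊎ b % 4 ≡ 3
*-%4≡3⇒ a b ab≡3 = %4≡3-residues (a % 4) (b % 4) (m%n<n a 4) (m%n<n b 4)
  (trans (sym (%-distribˡ-* a b 4)) ab≡3)

product-%4≡3⇒any : ∀ ns → product ns % 4 ≡ 3 → Any (λ m → m % 4 ≡ 3) ns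
product-%4≡3⇒any []       ()
product-%4≡3⇒any (m ∷ ns) h with *-%4≡3⇒ m (product ns) h
... | inj₁ m≡3  = here m≡3
... | inj₂ ns≡3 = there (product-%4≡3⇒any ns ns≡3)

prime-divisor-%4≡3 : ∀ n .{{_ : NonZero n}} → n % 4 ≡ 3 → ∃[ p ] (Prime p × p % 4 ≡ 3 × p ∣ n)
prime-divisor-%4≡3 n n≡3 =
  let p , p∈ , p≡3 = find (product-%4≡3⇒any factors (subst (λ m → m % 4 ≡ 3) isFactorisation n≡3))
  in p , All.lookup factorsPrime p∈ , p≡3 , subst (p ∣_) (sym isFactorisation) (∈⇒∣product p∈)
  where open PrimeFactorisation (factorise n)

0<m≤n⇒m∣n! : ∀ {m n} → 0 < m → m ≤ n → m ∣ n !
0<m≤n⇒m∣n! {suc m} _ m≤n = ∣-trans (m∣m*n (m !)) (m≤n⇒m!∣n! m≤n)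

∃prime-%4≡3-beyond : ∀ M → ∃[ p ] (Prime p × M < p × p % 4 ≡ 3)
∃prime-%4≡3-beyond M =
  let p , p-prime , p≡3 , p∣N = prime-divisor-%4≡3 N ([m+kn]%n≡m%n 3 (pred (M !)) 4)
  in p , p-prime , prime-divisor-beyond p-prime p∣N , p≡3
  where
  instance _ = M !≢0
  -- N = 4·M! − 1
  N : ℕ
  N = 3 + pred (M !) * 4
  N+1≡M!*4 : N + 1 ≡ M ! * 4
  N+1≡M!*4 = trans (+-comm N 1) (cong (_* 4) (suc-pred (M !)))
  prime-divisor-beyond : ∀ {p} → Prime p → p ∣ N → M < p
  prime-divisor-beyond {p} p-prime p∣N with M <? p
  ... | yes M<p = M<p
  ... | no  M≮p = ⊥-elim (¬prime[1] (subst Prime (∣1⇒≡1 p∣1) p-prime))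
    where
    p∣1 : p ∣ 1
    p∣1 = ∣m+n∣m⇒∣n (subst (p ∣_) (sym N+1≡M!*4)
            (∣m⇒∣m*n 4 (0<m≤n⇒m∣n! (>-nonZero⁻¹ p {{prime⇒nonZero p-prime}}) (≮⇒≥ M≮p)))) p∣N

%4≡3⇒4∣suc : ∀ n → n % 4 ≡ 3 → 4 ∣ suc n
%4≡3⇒4∣suc n n≡3 =
  divides (suc (n / 4)) (cong suc (trans (m≡m%n+[m/n]*n n 4) (cong (_+ n / 4 * 4) n≡3)))

length-filter-++-reject : ∀ {A : Set} {P : A → Set} (P? : Decidable P) xs {y} ys → ¬ P y →
                          length (filter P? (xs ++ y ∷ ys)) ≤ length xs + length (filter P? ys)
length-filter-++-reject P? []       ys ¬Py = ≤-reflexive (cong length (filter-reject P? ¬Py))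
length-filter-++-reject P? (x ∷ xs) ys ¬Py with P? x
... | yes _ = s≤s (length-filter-++-reject P? xs ys ¬Py)
... | no  _ = ≤-trans (length-filter-++-reject P? xs ys ¬Py) (n≤1+n _)

length-map-suc-upTo : ∀ n → length (map suc (upTo n)) ≡ n
length-map-suc-upTo n = trans (length-map suc (upTo n)) (length-upTo n)

V≤n : ∀ n .{{_ : NonZero n}} → V n ≤ n
V≤n n = ≤-trans (length-filter (λ a → Regular? n (ℤ.+ a)) (map suc (upTo n)))
                (≤-reflexive (length-map-suc-upTo n))

V[p]≡p : ∀ k → Prime (suc k) → V (suc k) ≡ suc k
V[p]≡p k p-prime = trans (cong length (filter-all (λ a → Regular? (suc k) (ℤ.+ a)) all-regular))
                          (length-map-suc-upTo (suc k))
  where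
  all-regular : All (λ a → Regular (suc k) (ℤ.+ a)) (map suc (upTo (suc k)))
  all-regular = map⁺ (applyUpTo⁺₁ _ (suc k) (prime⇒regular p-prime))

4∣6+r⇒V≤4+r : ∀ r → 4 ∣ 6 + r → V (6 + r) ≤ 4 + r
4∣6+r⇒V≤4+r r 4∣n = begin
  length (filter R? (1 ∷ 2 ∷ 3 ∷ 4 ∷ 5 ∷ 6 ∷ rest))
    ≤⟨ length-filter-++-reject R? (1 ∷ []) {2} (3 ∷ 4 ∷ 5 ∷ 6 ∷ rest) (¬regular-2+4k 4∣n (ℤ.+ 0)) ⟩
  1 + length (filter R? (3 ∷ 4 ∷ 5 ∷ 6 ∷ rest))
    ≤⟨ +-monoʳ-≤ 1 (length-filter-++-reject R? (3 ∷ 4 ∷ 5 ∷ []) {6} rest (¬regular-2+4k 4∣n (ℤ.+ 1))) ⟩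
  4 + length (filter R? rest)
    ≤⟨ +-monoʳ-≤ 4 (length-filter R? rest) ⟩
  4 + length rest
    ≡⟨ cong (4 +_) (trans (length-map suc (applyUpTo (6 +_) r)) (length-applyUpTo (6 +_) r)) ⟩
  4 + r ∎
  where
  open ≤-Reasoning
  R? : Decidable (λ a → Regular (6 + r) (ℤ.+ a))
  R? a = Regular? (6 + r) (ℤ.+ a)
  rest : List ℕ
  rest = map suc (applyUpTo (6 +_) r)

V<V[p] : ∀ n .{{_ : NonZero n}} k → Prime (suc k) → V n ≤ k → V n < V (suc k)
V<V[p] n k p-prime Vn≤k = ≤-trans (s≤s Vn≤k) (≤-reflexive (sym (V[p]≡p k p-prime)))

∃prime[7+j]-4∣8+j : ∀ m → ∃[ j ] (m ≤ j × Prime (7 + j) × 4 ∣ 8 + j)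
∃prime[7+j]-4∣8+j m = shift (∃prime-%4≡3-beyond (6 + m))
  where
  shift : ∃[ p ] (Prime p × 6 + m < p × p % 4 ≡ 3) → ∃[ j ] (m ≤ j × Prime (7 + j) × 4 ∣ 8 + j)
  shift (p , p-prime , 6+m<p , p%4≡3) with o , refl ← m≤n⇒∃[o]m+o≡n 6+m<p
    = m + o , m≤m+n m o , p-prime , %4≡3⇒4∣suc p p%4≡3

proposition1 : ((m : ℕ) → ∃[ k ] (m ≤ k × V (suc k) < V (suc (suc k))))
               × ((m : ℕ) → ∃[ k ] (m ≤ k × V (suc (suc k)) < V (suc k)))
proposition1 = (λ m → rises (∃prime[7+j]-4∣8+j m)) , (λ m → falls (∃prime[7+j]-4∣8+j m))
  where
  -- The prime is taken as a pattern-matched argument: projecting it out of the existential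
  -- would let the type checker unfold the factorisation that produced it.
  rises : ∀ {m} → ∃[ j ] (m ≤ j × Prime (7 + j) × 4 ∣ 8 + j)
        → ∃[ k ] (m ≤ k × V (suc k) < V (suc (suc k)))
  rises (j , m≤j , p-prime , _) =
    5 + j , ≤-trans m≤j (m≤n+m j 5) , V<V[p] (6 + j) (6 + j) p-prime (V≤n (6 + j))
  falls : ∀ {m} → ∃[ j ] (m ≤ j × Prime (7 + j) × 4 ∣ 8 + j)
        → ∃[ k ] (m ≤ k × V (suc (suc k)) < V (suc k))
  falls (j , m≤j , p-prime , 4∣p+1) =
    6 + j , ≤-trans m≤j (m≤n+m j 6) , V<V[p] (8 + j) (6 + j) p-prime (4∣6+r⇒V≤4+r (2 + j) 4∣p+1)
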